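{- Let $C$ be a non-trivial completely regular code in $H(n,q)$ with covering radius $\rho\ge1$ and intersection numbers $\alpha_i,\beta_i,\gamma_i$ ($0\le i\le\rho$), and let $C'$ be a non-trivial completely regular code in $H(n',q')$ with covering radius $\rho'\ge1$ and intersection numbers $\alpha'_i,\beta'_i,\gamma'_i$ ($0\le i\le\rho'$), where $\rho\le\rho'$. Then $C\times C'$ is a completely regular code in $H(n,q)\times H(n',q')$ if and only if there exist integers $n_1,n_2$ such that (a) $\gamma_i=n_1 i$ for $0\le i\le\rho$ and $\gamma'_i=n_1 i$ for $0\le i\le\rho'$; (b) $\beta_{\rho-i}=n_2 i$ for $0\le i\le\rho$ and $\beta'_{\rho'-i}=n_2 i$ for $0\le i\le\rho'$. In this case $C\times C'$ has covering radius $\bar\rho=\rho+\rho'$ and intersection numbers $\bar\gamma_i=n_1 i$ and $\bar\beta_i=n_2(\bar\rho-i)$ for $0\le i\le\bar\rho$.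
   Context: The Hamming graph $H(n,q)$ has vertex set $Q^n$ ($|Q|=q$), words adjacent iff they differ in exactly one coordinate. The cartesian product of graphs $\Gamma\times\Sigma$ has vertex set $V\Gamma\times V\Sigma$ with $(x,y)\sim(u,v)$ iff ($x=u$, $y\sim v$) or ($x\sim u$, $y=v$); the product code is $C\times C'=\{(c,c'):c\in C,c'\in C'\}$. A code is a nonempty vertex set; trivial if of size at most 1 or the whole vertex set. For a code $C$ in a connected graph, $C_i$ is the set of vertices at distance $i$ from $C$, and the covering radius $\rho$ is the largest $i$ with $C_i\neq\emptyset$; $C$ is completely regular if $\{C_0,\dots,C_\rho\}$ is an equitable partition, and then $\gamma_i,\alpha_i,\beta_i$ are the numbers of neighbours of a vertex of $C_i$ in $C_{i-1},C_i,C_{i+1}$. -}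

module Defs where

open import Level using (0ℓ)
open import Data.Nat using (ℕ; zero; suc; _+_; _*_; _∸_; _≤_; _<_)
open import Data.Fin using (Fin)
open import Data.Vec using (Vec; lookup)
open import Data.List using (List; length)
open import Data.List.Membership.Propositional using (_∈_)
open import Data.List.Relation.Unary.Unique.Propositional using (Unique)
open import Data.Product using (Σ; ∃; ∃-syntax; _×_; _,_)
open import Data.Sum using (_⊎_)
open import Data.Empty using (⊥)
open import Relation.Nullary using (¬_)
open import Relation.Binary.PropositionalEquality using (_≡_; _≢_)
open import Function.Bundles using (_⇔_)

record Graph : Set₁ where
  field
    V   : Set
    Adj : V → V → Set
open Graph public

HammingAdj : (n q : ℕ) → Vec (Fin q) n → Vec (Fin q) n → Set
HammingAdj n q x y =
  Σ (Fin n) λ i → (lookup x i ≢ lookup y i) × (∀ j → j ≢ i → lookup x j ≡ lookup y j)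

H : ℕ → ℕ → Graph
H n q = record { V = Vec (Fin q) n ; Adj = HammingAdj n q }

_□_ : Graph → Graph → Graph
Γ □ Σ' = record
  { V   = V Γ × V Σ'
  ; Adj = λ { (x , y) (u , v) → (x ≡ u × Adj Σ' y v) ⊎ (Adj Γ x u × y ≡ v) } }

-- A code is (given by) a predicate on vertices (nonemptiness imposed separately).
Code : Graph → Set₁
Code Γ = V Γ → Set

_⊠_ : {Γ Σ' : Graph} → Code Γ → Code Σ' → Code (Γ □ Σ')
(C ⊠ C') (x , y) = C x × C' y

data Walk (Γ : Graph) : ℕ → V Γ → V Γ → Set where
  here : ∀ {x} → Walk Γ zero x x
  step : ∀ {k x y z} → Adj Γ x y → Walk Γ k y z → Walk Γ (suc k) x z

Dist : (Γ : Graph) → V Γ → V Γ → ℕ → Set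
Dist Γ x y k = Walk Γ k x y × (∀ j → j < k → ¬ Walk Γ j x y)

Layer : (Γ : Graph) → Code Γ → ℕ → V Γ → Set
Layer Γ C i x = (∃[ c ] (C c × Walk Γ i x c)) × (∀ j → j < i → ∀ c → C c → ¬ Walk Γ j x c)

PrevLayer : (Γ : Graph) → Code Γ → ℕ → V Γ → Set
PrevLayer Γ C zero    x = ⊥
PrevLayer Γ C (suc i) x = Layer Γ C i x

NbCount : (Γ : Graph) → V Γ → (V Γ → Set) → ℕ → Set
NbCount Γ x S k =
  Σ (List (V Γ)) λ l → Unique l × (∀ y → (y ∈ l) ⇔ (Adj Γ x y × S y)) × length l ≡ k

Nonempty : {Γ : Graph} → Code Γ → Set
Nonempty {Γ} C = ∃[ c ] C c

NonTrivial : {Γ : Graph} → Code Γ → Set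
NonTrivial {Γ} C = (∃[ c ] ∃[ c' ] (C c × C c' × c ≢ c')) × (∃[ v ] ¬ C v)

CoveringRadius : (Γ : Graph) → Code Γ → ℕ → Set
CoveringRadius Γ C ρ =
  (∀ x → ∃[ i ] (i ≤ ρ × Layer Γ C i x)) × (∃[ x ] Layer Γ C ρ x)

IsCompletelyRegular : (Γ : Graph) → Code Γ → (ρ : ℕ) → (γ α β : ℕ → ℕ) → Set
IsCompletelyRegular Γ C ρ γ α β =
  Nonempty {Γ} C × CoveringRadius Γ C ρ ×
  (∀ i → i ≤ ρ → ∀ x → Layer Γ C i x →
     NbCount Γ x (PrevLayer Γ C i) (γ i) ×
     NbCount Γ x (Layer Γ C i) (α i) ×
     NbCount Γ x (Layer Γ C (suc i)) (β i))

CompletelyRegular : (Γ : Graph) → Code Γ → Set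
CompletelyRegular Γ C = ∃[ ρ ] ∃[ γ ] ∃[ α ] ∃[ β ] IsCompletelyRegular Γ C ρ γ α β

ParamCondition : (ρ ρ' : ℕ) (γ β γ' β' : ℕ → ℕ) (n₁ n₂ : ℕ) → Set
ParamCondition ρ ρ' γ β γ' β' n₁ n₂ =
  ((∀ i → i ≤ ρ → γ i ≡ n₁ * i) × (∀ i → i ≤ ρ' → γ' i ≡ n₁ * i)) ×
  ((∀ i → i ≤ ρ → β (ρ ∸ i) ≡ n₂ * i) × (∀ i → i ≤ ρ' → β' (ρ' ∸ i) ≡ n₂ * i))

module Submission where

-- A vertex (x , y) is at distance a + b from C × C' when x is at distance a
-- from C and y at distance b from C'; a neighbour of (x , y) changes one
-- coordinate, so (x , y) has γ a + γ' b, α a + α' b, β a + β' b neighbours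
-- in the layers a+b-1, a+b, a+b+1.  Hence C × C' is completely regular, of
-- radius ρ + ρ', iff these sums depend on a + b alone, and then they are its
-- intersection numbers.  For γ and for β read from the top this is an
-- additive Cauchy equation on a box, whose solutions are linear: conditions
-- (a) and (b).  The α-sum is then forced, as γ i + α i + β i is the valency.

open import Defs
open import Data.Nat using (ℕ; zero; suc; _+_; _*_; _∸_; _≤_; _<_; z≤n; s≤s)
open import Data.Nat.Properties
open import Data.Nat.Solver using (module +-*-Solver)
open import Data.Fin using (Fin; zero; suc; punchIn; punchOut)
import Data.Fin.Properties as Fin
open import Data.Vec using (Vec; []; _∷_; lookup)
open import Data.List using (List; []; _∷_; length; map; _++_; allFin)
open import Data.List.Properties using (length-++; length-map; length-tabulate)
open import Data.List.Relation.Unary.Any using (here)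
open import Data.List.Membership.Propositional using (_∈_)
open import Data.List.Membership.Propositional.Properties
  using (∈-map⁺; ∈-map⁻; ∈-++⁺ˡ; ∈-++⁺ʳ; ∈-++⁻; ∈-allFin)
open import Data.List.Membership.Propositional.Properties.WithK using (unique∧set⇒bag)
open import Data.List.Relation.Binary.BagAndSetEquality using (∼bag⇒↭)
open import Data.List.Relation.Binary.Permutation.Propositional.Properties using (↭-length)
open import Data.List.Relation.Unary.AllPairs using ([])
open import Data.List.Relation.Unary.Unique.Propositional using (Unique)
import Data.List.Relation.Unary.Unique.Propositional.Properties as Unique
open import Data.Product using (∃-syntax; _×_; _,_; proj₁; proj₂)
open import Data.Sum using (_⊎_; inj₁; inj₂; [_,_]′)
open import Data.Empty using (⊥; ⊥-elim)
open import Data.Unit using (⊤; tt)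
open import Relation.Nullary using (¬_)
open import Relation.Binary.Definitions using (tri<; tri≈; tri>)
open import Relation.Binary.PropositionalEquality
open import Function.Bundles using (_⇔_; mk⇔; Equivalence)
open Equivalence using (to; from)


Symmetric : Graph → Set
Symmetric Γ = ∀ {x y} → Adj Γ x y → Adj Γ y x

Irreflexive : Graph → Set
Irreflexive Γ = ∀ {x} → ¬ Adj Γ x x

Regular : Graph → ℕ → Set
Regular Γ D = ∀ x → NbCount Γ x (λ _ → ⊤) D

record SimpleRegular (Γ : Graph) (D : ℕ) : Set where
  field
    symmetric   : Symmetric Γ
    irreflexive : Irreflexive Γ
    regular     : Regular Γ D

Covered : (Γ : Graph) → Code Γ → Set
Covered Γ C = ∀ x → ∃[ i ] Layer Γ C i x

LayerCounts : (Γ : Graph) → Code Γ → ℕ → V Γ → ℕ → ℕ → ℕ → Set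
LayerCounts Γ C i x g a b =
  NbCount Γ x (PrevLayer Γ C i) g × NbCount Γ x (Layer Γ C i) a × NbCount Γ x (Layer Γ C (suc i)) b


same-members-length : {A : Set} {xs ys : List A} → Unique xs → Unique ys →
  (∀ {z} → (z ∈ xs) ⇔ (z ∈ ys)) → length xs ≡ length ys
same-members-length uxs uys same = ↭-length (∼bag⇒↭ (unique∧set⇒bag uxs uys same))

module _ {Γ : Graph} {x : V Γ} where

  transfer : {l₁ l₂ : List (V Γ)} {S₁ S₂ : V Γ → Set} →
    (∀ y → (y ∈ l₁) ⇔ (Adj Γ x y × S₁ y)) → (∀ y → (y ∈ l₂) ⇔ (Adj Γ x y × S₂ y)) →
    (∀ y → Adj Γ x y → S₁ y → S₂ y) → ∀ {y} → y ∈ l₁ → y ∈ l₂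
  transfer m₁ m₂ f {y} p = let (a , s) = to (m₁ y) p in from (m₂ y) (a , f y a s)

  count-unique : {S T : V Γ → Set} {k l : ℕ} → (∀ y → Adj Γ x y → S y ⇔ T y) →
    NbCount Γ x S k → NbCount Γ x T l → k ≡ l
  count-unique agree (ls , uS , mS , refl) (lt , uT , mT , refl) =
    same-members-length uS uT
      (mk⇔ (transfer mS mT (λ y a → to (agree y a))) (transfer mT mS (λ y a → from (agree y a))))

  count-functional : {S : V Γ → Set} {k l : ℕ} → NbCount Γ x S k → NbCount Γ x S l → k ≡ l
  count-functional = count-unique (λ _ _ → mk⇔ (λ s → s) (λ s → s))

  counts-functional : {C : Code Γ} {i g a b g' a' b' : ℕ} →
    LayerCounts Γ C i x g a b → LayerCounts Γ C i x g' a' b' → g ≡ g' × a ≡ a' × b ≡ b'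
  counts-functional (cg , ca , cb) (cg' , ca' , cb') =
    count-functional cg cg' , count-functional ca ca' , count-functional cb cb'

  count-empty : {S : V Γ → Set} {k : ℕ} → (∀ y → ¬ S y) → NbCount Γ x S k → k ≡ 0
  count-empty empty ([] , _ , _ , refl) = refl
  count-empty empty (y ∷ _ , _ , m , _) = ⊥-elim (empty y (proj₂ (to (m y) (here refl))))

  count-⊎ : {S T : V Γ → Set} {k l : ℕ} → (∀ {y} → S y → T y → ⊥) →
    NbCount Γ x S k → NbCount Γ x T l → NbCount Γ x (λ y → S y ⊎ T y) (k + l)
  count-⊎ {S} {T} disjoint (ls , uS , mS , refl) (lt , uT , mT , refl) =
    ls ++ lt ,
    Unique.++⁺ uS uT (λ (p , q) → disjoint (proj₂ (to (mS _) p)) (proj₂ (to (mT _) q))) ,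
    members , length-++ ls
    where
    members : ∀ y → (y ∈ ls ++ lt) ⇔ (Adj Γ x y × (S y ⊎ T y))
    members y = mk⇔
      (λ p → [ (λ p → let (a , s) = to (mS y) p in a , inj₁ s)
             , (λ p → let (a , t) = to (mT y) p in a , inj₂ t) ]′ (∈-++⁻ ls p))
      (λ { (a , inj₁ s) → ∈-++⁺ˡ (from (mS y) (a , s))
         ; (a , inj₂ t) → ∈-++⁺ʳ ls (from (mT y) (a , t)) })


module Layers (Γ : Graph) (C : Code Γ) where

  layer-unique : ∀ {i j x} → Layer Γ C i x → Layer Γ C j x → i ≡ j
  layer-unique {i} {j} ((c , c∈C , w) , min-i) ((c' , c'∈C , w') , min-j) with <-cmp i j
  ... | tri< i<j _ _ = ⊥-elim (min-j i i<j c c∈C w)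
  ... | tri≈ _ i≡j _ = i≡j
  ... | tri> _ _ j<i = ⊥-elim (min-i j j<i c' c'∈C w')

  layers-distinct : ∀ {i j y} → i < j → Layer Γ C i y → Layer Γ C j y → ⊥
  layers-distinct i<j Li Lj = <⇒≢ i<j (layer-unique Li Lj)

  -- The second vertex of a shortest walk from C_{i+1} to C lies in C_i.
  layer-step : ∀ {i x} → Layer Γ C (suc i) x → ∃[ u ] Layer Γ C i u
  layer-step ((c , c∈C , step x~u w) , min) =
    _ , (c , c∈C , w) , λ j j<i c' c'∈C w' → min (suc j) (s≤s j<i) c' c'∈C (step x~u w')

  layer-below : ∀ m {x} → Layer Γ C m x → ∀ i → i ≤ m → ∃[ y ] Layer Γ C i y
  layer-below m {x} Lm i i≤m with m≤n⇒m<n∨m≡n i≤m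
  ... | inj₂ refl = x , Lm
  layer-below (suc m) Lm i _ | inj₁ (s≤s i≤m) =
    let (u , Lu) = layer-step Lm in layer-below m Lu i i≤m

  adjacent-layers : Symmetric Γ → ∀ {x u i j} → Adj Γ x u →
    Layer Γ C i x → Layer Γ C j u → j ≤ suc i × i ≤ suc j
  adjacent-layers sym {i = i} {j} x~u ((c , c∈C , w) , min-j) ((c' , c'∈C , w') , min-i) =
    ≮⇒≥ (λ i+1<j → min-i (suc i) i+1<j c c∈C (step (sym x~u) w)) ,
    ≮⇒≥ (λ j+1<i → min-j (suc j) j+1<i c' c'∈C (step x~u w'))

  neighbour-layer : Symmetric Γ → Covered Γ C → ∀ {i x u} → Adj Γ x u → Layer Γ C i x →
    PrevLayer Γ C i u ⊎ Layer Γ C i u ⊎ Layer Γ C (suc i) u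
  neighbour-layer sym cov {i} {x} {u} x~u Li with cov u
  ... | j , Lj with adjacent-layers sym x~u Li Lj | <-cmp j i
  ... | _ , i≤1+j | tri< j<i _ _ with ≤-antisym i≤1+j j<i
  ...   | refl = inj₁ Lj
  neighbour-layer sym cov x~u Li | j , Lj | _ | tri≈ _ refl _ = inj₂ (inj₁ Lj)
  neighbour-layer sym cov x~u Li | j , Lj | j≤1+i , _ | tri> _ _ i<j with ≤-antisym j≤1+i i<j
  ...   | refl = inj₂ (inj₂ Lj)

  prev-disjoint : ∀ i {y} → PrevLayer Γ C i y → Layer Γ C i y ⊎ Layer Γ C (suc i) y → ⊥
  prev-disjoint (suc i) P (inj₁ L) = layers-distinct (n<1+n i) P L
  prev-disjoint (suc i) P (inj₂ L) = layers-distinct (m<n⇒m<1+n (n<1+n i)) P L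

  valency-split : ∀ {D} → Symmetric Γ → Regular Γ D → Covered Γ C → ∀ {i x g a b} →
    Layer Γ C i x → LayerCounts Γ C i x g a b → g + (a + b) ≡ D
  valency-split sym regular cov {i} {x} Li (cg , ca , cb) =
    count-unique {Γ} all-neighbours
      (count-⊎ {Γ} (prev-disjoint i) cg (count-⊎ {Γ} (layers-distinct (n<1+n i)) ca cb)) (regular x)
    where
    all-neighbours : ∀ y → Adj Γ x y →
      (PrevLayer Γ C i y ⊎ Layer Γ C i y ⊎ Layer Γ C (suc i) y) ⇔ ⊤
    all-neighbours y x~y = mk⇔ (λ _ → tt) (λ _ → neighbour-layer sym cov x~y Li)

  layer≤radius : ∀ {ρ} → CoveringRadius Γ C ρ → ∀ {i x} → Layer Γ C i x → i ≤ ρ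
  layer≤radius (covering , _) {x = x} Li =
    let (j , j≤ρ , Lj) = covering x in subst (_≤ _) (layer-unique Lj Li) j≤ρ

  beyond-radius : ∀ {ρ} → CoveringRadius Γ C ρ → ∀ y → ¬ Layer Γ C (suc ρ) y
  beyond-radius radius _ L = 1+n≰n (layer≤radius radius L)

  radius-unique : ∀ {r s} → CoveringRadius Γ C r → CoveringRadius Γ C s → r ≡ s
  radius-unique radius-r radius-s =
    ≤-antisym (layer≤radius radius-s (proj₂ (proj₂ radius-r)))
              (layer≤radius radius-r (proj₂ (proj₂ radius-s)))


module CompletelyRegularCode (Γ : Graph) (C : Code Γ) (ρ : ℕ) (γ α β : ℕ → ℕ)
  (cr : IsCompletelyRegular Γ C ρ γ α β) where
  open Layers Γ C

  radius : CoveringRadius Γ C ρ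
  radius = proj₁ (proj₂ cr)

  covered : Covered Γ C
  covered x = let (i , _ , Li) = proj₁ radius x in i , Li

  layer≤ρ : ∀ {i x} → Layer Γ C i x → i ≤ ρ
  layer≤ρ = layer≤radius radius

  layer-inhabited : ∀ i → i ≤ ρ → ∃[ x ] Layer Γ C i x
  layer-inhabited i i≤ρ = let (x , Lρ) = proj₂ radius in layer-below ρ Lρ i i≤ρ

  counts : ∀ {i x} → Layer Γ C i x → LayerCounts Γ C i x (γ i) (α i) (β i)
  counts {i} {x} Li = proj₂ (proj₂ cr) i (layer≤ρ Li) x Li

  γ₀≡0 : γ 0 ≡ 0
  γ₀≡0 = let (x , L₀) = layer-inhabited 0 z≤n in count-empty {Γ} (λ _ ()) (proj₁ (counts L₀))

  βρ≡0 : β ρ ≡ 0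
  βρ≡0 = let (x , Lρ) = proj₂ radius in
    count-empty {Γ} (beyond-radius radius) (proj₂ (proj₂ (counts Lρ)))

  valency-sum : ∀ {D} → Symmetric Γ → Regular Γ D → ∀ i → i ≤ ρ → γ i + (α i + β i) ≡ D
  valency-sum sym regular i i≤ρ =
    let (x , Li) = layer-inhabited i i≤ρ in valency-split sym regular covered Li (counts Li)

parameters-unique : (Γ : Graph) (C : Code Γ) {ρ ρ₂ : ℕ} {γ α β γ₂ α₂ β₂ : ℕ → ℕ} →
  IsCompletelyRegular Γ C ρ γ α β → IsCompletelyRegular Γ C ρ₂ γ₂ α₂ β₂ →
  ρ ≡ ρ₂ × (∀ i → i ≤ ρ → γ i ≡ γ₂ i × α i ≡ α₂ i × β i ≡ β₂ i)
parameters-unique Γ C {ρ} {ρ₂} {γ} {α} {β} {γ₂} {α₂} {β₂} cr cr₂ =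
  Layers.radius-unique Γ C A.radius B.radius ,
  λ i i≤ρ → let (x , Li) = A.layer-inhabited i i≤ρ in counts-functional {Γ} (A.counts Li) (B.counts Li)
  where
  module A = CompletelyRegularCode Γ C ρ γ α β cr
  module B = CompletelyRegularCode Γ C ρ₂ γ₂ α₂ β₂ cr₂


other-symbols : ∀ {q} → Fin q → List (Fin q)
other-symbols {suc q} c = map (punchIn c) (allFin q)

other-symbols-length : ∀ {q} (c : Fin q) → length (other-symbols c) ≡ q ∸ 1
other-symbols-length {suc q} c = trans (length-map (punchIn c) (allFin q)) (length-tabulate _)

other-symbols-unique : ∀ {q} (c : Fin q) → Unique (other-symbols c)
other-symbols-unique {suc q} c =
  Unique.map⁺ (λ {a} {b} → Fin.punchIn-injective c a b) (Unique.allFin⁺ q)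

other-symbols-∈ : ∀ {q} (c d : Fin q) → d ∈ other-symbols c ⇔ (c ≢ d)
other-symbols-∈ {suc q} c d = mk⇔ differs listed
  where
  differs : d ∈ other-symbols c → c ≢ d
  differs d∈ with ∈-map⁻ (punchIn c) d∈
  ... | k , _ , refl = λ e → Fin.punchInᵢ≢i c k (sym e)
  listed : c ≢ d → d ∈ other-symbols c
  listed c≢d = subst (_∈ other-symbols c) (Fin.punchIn-punchOut c≢d)
                     (∈-map⁺ (punchIn c) (∈-allFin (punchOut c≢d)))

vec-ext : ∀ {n q} (xs ys : Vec (Fin q) n) → (∀ j → lookup xs j ≡ lookup ys j) → xs ≡ ys
vec-ext [] [] _ = refl
vec-ext (x ∷ xs) (y ∷ ys) agree = cong₂ _∷_ (agree zero) (vec-ext xs ys (λ j → agree (suc j)))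

cons-adjacent : ∀ {n q} {c d : Fin q} {xs ys : Vec (Fin q) n} →
  HammingAdj (suc n) q (c ∷ xs) (d ∷ ys) ⇔ ((c ≢ d × xs ≡ ys) ⊎ (c ≡ d × HammingAdj n q xs ys))
cons-adjacent {c = c} {d} {xs} {ys} = mk⇔ split join
  where
  split : HammingAdj _ _ (c ∷ xs) (d ∷ ys) → (c ≢ d × xs ≡ ys) ⊎ (c ≡ d × HammingAdj _ _ xs ys)
  split (zero , differ , agree) = inj₁ (differ , vec-ext xs ys (λ j → agree (suc j) (λ ())))
  split (suc i , differ , agree) =
    inj₂ (agree zero (λ ()) , i , differ , λ j j≢i → agree (suc j) (λ e → j≢i (Fin.suc-injective e)))
  join : (c ≢ d × xs ≡ ys) ⊎ (c ≡ d × HammingAdj _ _ xs ys) → HammingAdj _ _ (c ∷ xs) (d ∷ ys)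
  join (inj₁ (c≢d , refl)) = zero , c≢d , λ { zero j≢0 → ⊥-elim (j≢0 refl) ; (suc j) _ → refl }
  join (inj₂ (refl , i , differ , agree)) =
    suc i , differ , λ { zero _ → refl ; (suc j) j≢i → agree j (λ e → j≢i (cong suc e)) }

neighbours : ∀ {n q} → Vec (Fin q) n → List (Vec (Fin q) n)
neighbours [] = []
neighbours (c ∷ xs) = map (_∷ xs) (other-symbols c) ++ map (c ∷_) (neighbours xs)

neighbours-length : ∀ {n q} (x : Vec (Fin q) n) → length (neighbours x) ≡ n * (q ∸ 1)
neighbours-length [] = refl
neighbours-length {suc n} {q} (c ∷ xs) = begin
  length (map (_∷ xs) (other-symbols c) ++ map (c ∷_) (neighbours xs))
    ≡⟨ length-++ (map (_∷ xs) (other-symbols c)) ⟩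
  length (map (_∷ xs) (other-symbols c)) + length (map (c ∷_) (neighbours xs))
    ≡⟨ cong₂ _+_ (length-map _ (other-symbols c)) (length-map _ (neighbours xs)) ⟩
  length (other-symbols c) + length (neighbours xs)
    ≡⟨ cong₂ _+_ (other-symbols-length c) (neighbours-length xs) ⟩
  (q ∸ 1) + n * (q ∸ 1) ∎
  where open ≡-Reasoning

-- Distinct neighbours: changing the head and changing the tail never agree.
∷-injective : ∀ {n q} {a b : Fin q} {xs ys : Vec (Fin q) n} → a ∷ xs ≡ b ∷ ys → a ≡ b × xs ≡ ys
∷-injective refl = refl , refl

neighbours-unique : ∀ {n q} (x : Vec (Fin q) n) → Unique (neighbours x)
neighbours-unique [] = []
neighbours-unique (c ∷ xs) =
  Unique.++⁺ (Unique.map⁺ (λ e → proj₁ (∷-injective e)) (other-symbols-unique c))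
             (Unique.map⁺ (λ e → proj₂ (∷-injective e)) (neighbours-unique xs))
             head-changed-or-not
  where
  head-changed-or-not : ∀ {v} → ¬ (v ∈ map (_∷ xs) (other-symbols c) × v ∈ map (c ∷_) (neighbours xs))
  head-changed-or-not (p , q) with ∈-map⁻ _ p | ∈-map⁻ _ q
  ... | d , d∈ , refl | _ , _ , e = to (other-symbols-∈ c d) d∈ (sym (proj₁ (∷-injective e)))

neighbours-∈ : ∀ {n q} (x y : Vec (Fin q) n) → (y ∈ neighbours x) ⇔ HammingAdj n q x y
neighbours-∈ [] [] = mk⇔ (λ ()) (λ ())
neighbours-∈ (c ∷ xs) (d ∷ ys) = mk⇔ listed⇒adjacent adjacent⇒listed
  where
  listed⇒adjacent : d ∷ ys ∈ neighbours (c ∷ xs) → HammingAdj _ _ (c ∷ xs) (d ∷ ys)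
  listed⇒adjacent p with ∈-++⁻ (map (_∷ xs) (other-symbols c)) p
  ... | inj₁ p₁ with ∈-map⁻ _ p₁
  ...   | d , d∈ , refl = from cons-adjacent (inj₁ (to (other-symbols-∈ c d) d∈ , refl))
  listed⇒adjacent p | inj₂ p₂ with ∈-map⁻ _ p₂
  ...   | ys , ys∈ , refl = from cons-adjacent (inj₂ (refl , to (neighbours-∈ xs ys) ys∈))
  adjacent⇒listed : HammingAdj _ _ (c ∷ xs) (d ∷ ys) → d ∷ ys ∈ neighbours (c ∷ xs)
  adjacent⇒listed adj with to cons-adjacent adj
  ... | inj₁ (c≢d , refl) = ∈-++⁺ˡ (∈-map⁺ (_∷ xs) (from (other-symbols-∈ c d) c≢d))
  ... | inj₂ (refl , adj') =
    ∈-++⁺ʳ (map (_∷ xs) (other-symbols c)) (∈-map⁺ (c ∷_) (from (neighbours-∈ xs ys) adj'))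

hamming-simple-regular : ∀ {n q} → SimpleRegular (H n q) (n * (q ∸ 1))
hamming-simple-regular = record
  { symmetric   = λ (i , differ , agree) → i , (λ e → differ (sym e)) , λ j j≢i → sym (agree j j≢i)
  ; irreflexive = λ (_ , differ , _) → differ refl
  ; regular     = λ x → neighbours x , neighbours-unique x ,
      (λ y → mk⇔ (λ p → to (neighbours-∈ x y) p , tt) (λ (adj , _) → from (neighbours-∈ x y) adj)) ,
      neighbours-length x
  }


module ProductGraph (Γ Σ : Graph) where

  P : Graph
  P = Γ □ Σ

  walk-right : ∀ {b x y v} → Walk Σ b y v → Walk P b (x , y) (x , v)
  walk-right here = here
  walk-right (step y~y' w) = step (inj₁ (refl , y~y')) (walk-right w)

  walk-pair : ∀ {a b x y u v} → Walk Γ a x u → Walk Σ b y v → Walk P (a + b) (x , y) (u , v)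
  walk-pair here w' = walk-right w'
  walk-pair (step x~x' w) w' = step (inj₂ (x~x' , refl)) (walk-pair w w')

  walk-split : ∀ {k x y u v} → Walk P k (x , y) (u , v) →
    ∃[ a ] ∃[ b ] (a + b ≡ k × Walk Γ a x u × Walk Σ b y v)
  walk-split here = 0 , 0 , refl , here , here
  walk-split (step (inj₁ (refl , y~y')) w) =
    let (a , b , a+b≡k , w₁ , w₂) = walk-split w in a , suc b , trans (+-suc a b) (cong suc a+b≡k) , w₁ , step y~y' w₂
  walk-split (step (inj₂ (x~x' , refl)) w) =
    let (a , b , a+b≡k , w₁ , w₂) = walk-split w in suc a , b , cong suc a+b≡k , step x~x' w₁ , w₂

  -- The neighbours of (x , y) are the (u , y) with u ~ x and the (x , v) with
  -- v ~ y; these are distinct since Γ has no loops.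
  count-□ : Irreflexive Γ → ∀ {x y} {S : V P → Set} {T₁ : V Γ → Set} {T₂ : V Σ → Set} {k₁ k₂} →
    (∀ u → S (u , y) ⇔ T₁ u) → (∀ v → S (x , v) ⇔ T₂ v) →
    NbCount Γ x T₁ k₁ → NbCount Σ y T₂ k₂ → NbCount P (x , y) S (k₁ + k₂)
  count-□ irreflexive {x} {y} {S} S⇔T₁ S⇔T₂ (l₁ , u₁ , m₁ , refl) (l₂ , u₂ , m₂ , refl) =
    l , unique , members ,
    trans (length-++ (map (_, y) l₁)) (cong₂ _+_ (length-map _ l₁) (length-map _ l₂))
    where
    l : List (V P)
    l = map (_, y) l₁ ++ map (x ,_) l₂
    unique : Unique l
    unique = Unique.++⁺ (Unique.map⁺ (cong proj₁) u₁) (Unique.map⁺ (cong proj₂) u₂) disjoint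
      where
      disjoint : ∀ {z} → ¬ (z ∈ map (_, y) l₁ × z ∈ map (x ,_) l₂)
      disjoint (p , q) with ∈-map⁻ _ p | ∈-map⁻ _ q
      ... | u , u∈ , refl | _ , _ , refl = irreflexive (proj₁ (to (m₁ u) u∈))
    members : ∀ z → (z ∈ l) ⇔ (Adj P (x , y) z × S z)
    members (u , v) = mk⇔ listed⇒ ⇒listed
      where
      listed⇒ : (u , v) ∈ l → Adj P (x , y) (u , v) × S (u , v)
      listed⇒ p with ∈-++⁻ (map (_, y) l₁) p
      ... | inj₁ p₁ with ∈-map⁻ _ p₁
      ...   | _ , u∈ , refl = let (x~u , t) = to (m₁ u) u∈ in inj₂ (x~u , refl) , from (S⇔T₁ u) t
      listed⇒ p | inj₂ p₂ with ∈-map⁻ _ p₂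
      ...   | _ , v∈ , refl = let (y~v , t) = to (m₂ v) v∈ in inj₁ (refl , y~v) , from (S⇔T₂ v) t
      ⇒listed : Adj P (x , y) (u , v) × S (u , v) → (u , v) ∈ l
      ⇒listed (inj₁ (refl , y~v) , s) = ∈-++⁺ʳ (map (_, y) l₁) (∈-map⁺ (x ,_) (from (m₂ v) (y~v , to (S⇔T₂ v) s)))
      ⇒listed (inj₂ (x~u , refl) , s) = ∈-++⁺ˡ (∈-map⁺ (_, y) (from (m₁ u) (x~u , to (S⇔T₁ u) s)))

  module ProductCode (C : Code Γ) (C' : Code Σ) where

    CC : Code P
    CC = _⊠_ {Γ} {Σ} C C'

    product-layer : ∀ {a b x y} → Layer Γ C a x → Layer Σ C' b y → Layer P CC (a + b) (x , y)
    product-layer {a} {b} ((c , c∈C , w) , min) ((c' , c'∈C' , w') , min') =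
      ((c , c') , (c∈C , c'∈C') , walk-pair w w') , no-shorter
      where
      no-shorter : ∀ j → j < a + b → ∀ z → CC z → ¬ Walk P j _ z
      no-shorter j j<a+b (d , d') (d∈C , d'∈C') w'' with walk-split w''
      ... | j₁ , j₂ , refl , w₁ , w₂ =
        <⇒≱ j<a+b (+-mono-≤ (≮⇒≥ (λ j₁<a → min j₁ j₁<a d d∈C w₁)) (≮⇒≥ (λ j₂<b → min' j₂ j₂<b d' d'∈C' w₂)))

    module Covering (covered : Covered Γ C) (covered' : Covered Σ C') where

      layer-index : ∀ {a b k x y} → Layer Γ C a x → Layer Σ C' b y → Layer P CC k (x , y) → k ≡ a + b
      layer-index La Lb L = Layers.layer-unique P CC L (product-layer La Lb)

      left-layer : ∀ {b y} → Layer Σ C' b y → ∀ a u → Layer P CC (a + b) (u , y) ⇔ Layer Γ C a u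
      left-layer {b} {y} Lb a u = mk⇔ down (λ La → product-layer La Lb)
        where
        down : Layer P CC (a + b) (u , y) → Layer Γ C a u
        down L = let (a' , La') = covered u in
          subst (λ i → Layer Γ C i u) (+-cancelʳ-≡ b a' a (sym (layer-index La' Lb L))) La'

      right-layer : ∀ {a x} → Layer Γ C a x → ∀ b v → Layer P CC (a + b) (x , v) ⇔ Layer Σ C' b v
      right-layer {a} {x} La b v = mk⇔ down (product-layer La)
        where
        down : Layer P CC (a + b) (x , v) → Layer Σ C' b v
        down L = let (b' , Lb') = covered' v in
          subst (λ i → Layer Σ C' i v) (+-cancelˡ-≡ a b' b (sym (layer-index La Lb' L))) Lb'

      left-prev : ∀ {b y} → Layer Σ C' b y → ∀ a u → PrevLayer P CC (a + b) (u , y) ⇔ PrevLayer Γ C a u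
      left-prev Lb (suc a) u = left-layer Lb a u
      left-prev {zero} Lb zero u = mk⇔ (λ ()) (λ ())
      left-prev {suc b} Lb zero u = mk⇔ impossible (λ ())
        where
        impossible : Layer P CC b (u , _) → ⊥
        impossible L = let (a' , La') = covered u in m+1+n≢n a' (sym (layer-index La' Lb L))

      right-prev : ∀ {a x} → Layer Γ C a x → ∀ b v → PrevLayer P CC (a + b) (x , v) ⇔ PrevLayer Σ C' b v
      right-prev {a} {x} La (suc b) v =
        subst (λ k → PrevLayer P CC k (x , v) ⇔ Layer Σ C' b v) (sym (+-suc a b)) (right-layer La b v)
      right-prev {zero} La zero v = mk⇔ (λ ()) (λ ())
      right-prev {suc a} {x} La zero v = mk⇔ impossible (λ ())
        where
        impossible : Layer P CC (a + 0) (x , v) → ⊥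
        impossible L = let (b' , Lb') = covered' v in
          m≢1+m+n a (trans (sym (+-identityʳ a)) (layer-index La Lb' L))

      right-next : ∀ {a x} → Layer Γ C a x → ∀ b v → Layer P CC (suc (a + b)) (x , v) ⇔ Layer Σ C' (suc b) v
      right-next {a} {x} La b v =
        subst (λ k → Layer P CC k (x , v) ⇔ Layer Σ C' (suc b) v) (+-suc a b) (right-layer La (suc b) v)

      product-counts : Irreflexive Γ → ∀ {a b x y g α β g' α' β'} →
        Layer Γ C a x → Layer Σ C' b y → LayerCounts Γ C a x g α β → LayerCounts Σ C' b y g' α' β' →
        LayerCounts P CC (a + b) (x , y) (g + g') (α + α') (β + β')
      product-counts irreflexive {a} {b} La Lb (cg , cα , cβ) (cg' , cα' , cβ') =
        count-□ irreflexive (left-prev Lb a) (right-prev La b) cg cg' ,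
        count-□ irreflexive (left-layer Lb a) (right-layer La b) cα cα' ,
        count-□ irreflexive (left-layer Lb (suc a)) (right-next La b) cβ cβ'


additive⇒linear : (f g h : ℕ → ℕ) (R R' : ℕ) → 1 ≤ R → 1 ≤ R' → f 0 ≡ 0 → g 0 ≡ 0 →
  (∀ a b → a ≤ R → b ≤ R' → f a + g b ≡ h (a + b)) →
  (∀ a → a ≤ R → f a ≡ f 1 * a) × (∀ b → b ≤ R' → g b ≡ f 1 * b)
additive⇒linear f g h R R' 1≤R 1≤R' f0≡0 g0≡0 additive = f-linear , g-linear
  where
  open ≡-Reasoning
  -- moving one unit from the first argument to the second
  g-step : ∀ b → suc b ≤ R' → g (suc b) ≡ f 1 + g b
  g-step b 1+b≤R' = begin
    g (suc b)       ≡⟨ cong (_+ g (suc b)) (sym f0≡0) ⟩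
    f 0 + g (suc b) ≡⟨ additive 0 (suc b) z≤n 1+b≤R' ⟩
    h (1 + b)       ≡⟨ additive 1 b 1≤R (≤-trans (n≤1+n b) 1+b≤R') ⟨
    f 1 + g b       ∎
  f-step : ∀ a → suc a ≤ R → f (suc a) ≡ f a + g 1
  f-step a 1+a≤R = begin
    f (suc a)       ≡⟨ +-identityʳ (f (suc a)) ⟨
    f (suc a) + 0   ≡⟨ cong (f (suc a) +_) g0≡0 ⟨
    f (suc a) + g 0 ≡⟨ additive (suc a) 0 1+a≤R z≤n ⟩
    h (suc a + 0)   ≡⟨ cong h (trans (+-identityʳ (suc a)) (+-comm 1 a)) ⟩
    h (a + 1)       ≡⟨ additive a 1 (≤-trans (n≤1+n a) 1+a≤R) 1≤R' ⟨
    f a + g 1       ∎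
  g1≡f1 : g 1 ≡ f 1
  g1≡f1 = trans (g-step 0 1≤R') (trans (cong (f 1 +_) g0≡0) (+-identityʳ (f 1)))
  f-linear : ∀ a → a ≤ R → f a ≡ f 1 * a
  f-linear zero _ = trans f0≡0 (sym (*-zeroʳ (f 1)))
  f-linear (suc a) 1+a≤R = begin
    f (suc a)       ≡⟨ f-step a 1+a≤R ⟩
    f a + g 1       ≡⟨ cong₂ _+_ (f-linear a (≤-trans (n≤1+n a) 1+a≤R)) g1≡f1 ⟩
    f 1 * a + f 1   ≡⟨ +-comm (f 1 * a) (f 1) ⟩
    f 1 + f 1 * a   ≡⟨ *-suc (f 1) a ⟨
    f 1 * suc a     ∎
  g-linear : ∀ b → b ≤ R' → g b ≡ f 1 * b
  g-linear zero _ = trans g0≡0 (sym (*-zeroʳ (f 1)))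
  g-linear (suc b) 1+b≤R' = begin
    g (suc b)       ≡⟨ g-step b 1+b≤R' ⟩
    f 1 + g b       ≡⟨ cong (f 1 +_) (g-linear b (≤-trans (n≤1+n b) 1+b≤R')) ⟩
    f 1 + f 1 * b   ≡⟨ *-suc (f 1) b ⟨
    f 1 * suc b     ∎

∸-+-distrib : ∀ {r r' a b} → a ≤ r → b ≤ r' → (r ∸ a) + (r' ∸ b) ≡ (r + r') ∸ (a + b)
∸-+-distrib {r} {r'} {a} {b} a≤r b≤r' = begin
  (r ∸ a) + (r' ∸ b)  ≡⟨ +-∸-assoc (r ∸ a) b≤r' ⟨
  (r ∸ a) + r' ∸ b    ≡⟨ cong (_∸ b) (+-∸-comm r' a≤r) ⟨
  r + r' ∸ a ∸ b      ≡⟨ ∸-+-assoc (r + r') a b ⟩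
  (r + r') ∸ (a + b)  ∎
  where open ≡-Reasoning

reversed-linear : (f : ℕ → ℕ) (r c : ℕ) → (∀ i → i ≤ r → f (r ∸ i) ≡ c * i) →
  ∀ a → a ≤ r → f a ≡ c * (r ∸ a)
reversed-linear f r c reversed a a≤r =
  subst (λ j → f j ≡ c * (r ∸ a)) (m∸[m∸n]≡n a≤r) (reversed (r ∸ a) (m∸n≤m r a))

middle-sum : ∀ g m b g' m' b' d d' → g + (m + b) ≡ d → g' + (m' + b') ≡ d' →
  m + m' ≡ (d + d') ∸ ((g + g') + (b + b'))
middle-sum g m b g' m' b' d d' refl refl = sym (begin
  (g + (m + b)) + (g' + (m' + b')) ∸ ((g + g') + (b + b'))
    ≡⟨ cong (_∸ ((g + g') + (b + b'))) (regroup g m b g' m' b') ⟩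
  (m + m') + ((g + g') + (b + b')) ∸ ((g + g') + (b + b'))
    ≡⟨ m+n∸n≡m (m + m') ((g + g') + (b + b')) ⟩
  m + m' ∎)
  where
  open ≡-Reasoning
  open +-*-Solver
  regroup : ∀ g m b g' m' b' → (g + (m + b)) + (g' + (m' + b')) ≡ (m + m') + ((g + g') + (b + b'))
  regroup = solve 6 (λ g m b g' m' b' → (g :+ (m :+ b)) :+ (g' :+ (m' :+ b')) := (m :+ m') :+ ((g :+ g') :+ (b :+ b'))) refl


module ProductOfCodes (Γ Σ : Graph) (irreflexive : Irreflexive Γ)
  (C : Code Γ) (ρ : ℕ) (γ α β : ℕ → ℕ) (cr : IsCompletelyRegular Γ C ρ γ α β)
  (C' : Code Σ) (ρ' : ℕ) (γ' α' β' : ℕ → ℕ) (cr' : IsCompletelyRegular Σ C' ρ' γ' α' β') where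

  open ProductGraph Γ Σ public using (P)
  open ProductGraph Γ Σ hiding (P)
  open ProductCode C C' public using (CC)
  open ProductCode C C' hiding (CC)
  module A = CompletelyRegularCode Γ C ρ γ α β cr
  module B = CompletelyRegularCode Σ C' ρ' γ' α' β' cr'
  open Covering A.covered B.covered

  SumsDependOnTotal : (γ̄ ᾱ β̄ : ℕ → ℕ) → Set
  SumsDependOnTotal γ̄ ᾱ β̄ = ∀ a b → a ≤ ρ → b ≤ ρ' →
    (γ a + γ' b ≡ γ̄ (a + b)) × (α a + α' b ≡ ᾱ (a + b)) × (β a + β' b ≡ β̄ (a + b))

  sum-counts : ∀ {a b x y} → Layer Γ C a x → Layer Σ C' b y →
    LayerCounts P CC (a + b) (x , y) (γ a + γ' b) (α a + α' b) (β a + β' b)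
  sum-counts La Lb = product-counts irreflexive La Lb (A.counts La) (B.counts Lb)

  product-radius : CoveringRadius P CC (ρ + ρ')
  product-radius = covering , farthest
    where
    covering : ∀ z → ∃[ i ] (i ≤ ρ + ρ' × Layer P CC i z)
    covering (x , y) = let (a , La) = A.covered x ; (b , Lb) = B.covered y in
      a + b , +-mono-≤ (A.layer≤ρ La) (B.layer≤ρ Lb) , product-layer La Lb
    farthest : ∃[ z ] Layer P CC (ρ + ρ') z
    farthest = let (x , La) = proj₂ A.radius ; (y , Lb) = proj₂ B.radius in (x , y) , product-layer La Lb

  product-completely-regular : ∀ γ̄ ᾱ β̄ → SumsDependOnTotal γ̄ ᾱ β̄ →
    IsCompletelyRegular P CC (ρ + ρ') γ̄ ᾱ β̄
  product-completely-regular γ̄ ᾱ β̄ sums =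
    ((proj₁ (proj₁ cr) , proj₁ (proj₁ cr')) , (proj₂ (proj₁ cr) , proj₂ (proj₁ cr'))) ,
    product-radius , regular-counts
    where
    relabel : ∀ {i z g a b g' a' b'} → (g ≡ g') × (a ≡ a') × (b ≡ b') →
      LayerCounts P CC i z g a b → LayerCounts P CC i z g' a' b'
    relabel (refl , refl , refl) counts = counts
    regular-counts : ∀ i → i ≤ ρ + ρ' → ∀ z → Layer P CC i z → LayerCounts P CC i z (γ̄ i) (ᾱ i) (β̄ i)
    regular-counts i _ (x , y) L with A.covered x | B.covered y
    ... | a , La | b , Lb with layer-index La Lb L
    ...   | refl = relabel (sums a b (A.layer≤ρ La) (B.layer≤ρ Lb)) (sum-counts La Lb)

  product-parameters : ∀ {ρ̄ γ̄ ᾱ β̄} → IsCompletelyRegular P CC ρ̄ γ̄ ᾱ β̄ → SumsDependOnTotal γ̄ ᾱ β̄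
  product-parameters {ρ̄} {γ̄} {ᾱ} {β̄} crp a b a≤ρ b≤ρ' =
    let (x , La) = A.layer-inhabited a a≤ρ ; (y , Lb) = B.layer-inhabited b b≤ρ' in
    counts-functional {P} (sum-counts La Lb) (Product.counts (product-layer La Lb))
    where module Product = CompletelyRegularCode P CC ρ̄ γ̄ ᾱ β̄ crp


module ParameterConditions (Γ Σ : Graph) (D D' : ℕ) (G : SimpleRegular Γ D) (G' : SimpleRegular Σ D')
  (C : Code Γ) (ρ : ℕ) (γ α β : ℕ → ℕ) (cr : IsCompletelyRegular Γ C ρ γ α β)
  (C' : Code Σ) (ρ' : ℕ) (γ' α' β' : ℕ → ℕ) (cr' : IsCompletelyRegular Σ C' ρ' γ' α' β') where

  open ProductOfCodes Γ Σ (SimpleRegular.irreflexive G) C ρ γ α β cr C' ρ' γ' α' β' cr'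
  open SimpleRegular

  -- Necessity: γ and β, read from the top, solve the additive Cauchy equation.
  conditions-necessary : 1 ≤ ρ → 1 ≤ ρ' → CompletelyRegular P CC →
    ∃[ n₁ ] ∃[ n₂ ] ParamCondition ρ ρ' γ β γ' β' n₁ n₂
  conditions-necessary 1≤ρ 1≤ρ' (ρ̄ , γ̄ , ᾱ , β̄ , crp) =
    γ 1 , β (ρ ∸ 1) ,
    additive⇒linear γ γ' γ̄ ρ ρ' 1≤ρ 1≤ρ' A.γ₀≡0 B.γ₀≡0 (λ a b a≤ρ b≤ρ' → proj₁ (sums a b a≤ρ b≤ρ')) ,
    additive⇒linear (λ i → β (ρ ∸ i)) (λ j → β' (ρ' ∸ j)) (λ k → β̄ ((ρ + ρ') ∸ k))
      ρ ρ' 1≤ρ 1≤ρ' A.βρ≡0 B.βρ≡0 reversed-sums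
    where
    sums : SumsDependOnTotal γ̄ ᾱ β̄
    sums = product-parameters crp
    reversed-sums : ∀ a b → a ≤ ρ → b ≤ ρ' → β (ρ ∸ a) + β' (ρ' ∸ b) ≡ β̄ ((ρ + ρ') ∸ (a + b))
    reversed-sums a b a≤ρ b≤ρ' =
      trans (proj₂ (proj₂ (sums (ρ ∸ a) (ρ' ∸ b) (m∸n≤m ρ a) (m∸n≤m ρ' b)))) (cong β̄ (∸-+-distrib a≤ρ b≤ρ'))

  module _ (n₁ n₂ : ℕ) (conditions : ParamCondition ρ ρ' γ β γ' β' n₁ n₂) where

    -- The intersection numbers of C × C' prescribed by (a) and (b); the
    -- middle one is forced by the valency D + D' of the product graph.
    product-γ product-α product-β : ℕ → ℕ
    product-γ k = n₁ * k
    product-β k = n₂ * ((ρ + ρ') ∸ k)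
    product-α k = (D + D') ∸ (product-γ k + product-β k)

    γ-sum : ∀ a b → a ≤ ρ → b ≤ ρ' → γ a + γ' b ≡ product-γ (a + b)
    γ-sum a b a≤ρ b≤ρ' =
      trans (cong₂ _+_ (proj₁ (proj₁ conditions) a a≤ρ) (proj₂ (proj₁ conditions) b b≤ρ'))
            (sym (*-distribˡ-+ n₁ a b))

    β-sum : ∀ a b → a ≤ ρ → b ≤ ρ' → β a + β' b ≡ product-β (a + b)
    β-sum a b a≤ρ b≤ρ' = begin
      β a + β' b                   ≡⟨ cong₂ _+_ (reversed-linear β ρ n₂ (proj₁ (proj₂ conditions)) a a≤ρ)
                                                (reversed-linear β' ρ' n₂ (proj₂ (proj₂ conditions)) b b≤ρ') ⟩
      n₂ * (ρ ∸ a) + n₂ * (ρ' ∸ b) ≡⟨ *-distribˡ-+ n₂ (ρ ∸ a) (ρ' ∸ b) ⟨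
      n₂ * ((ρ ∸ a) + (ρ' ∸ b))    ≡⟨ cong (n₂ *_) (∸-+-distrib a≤ρ b≤ρ') ⟩
      n₂ * ((ρ + ρ') ∸ (a + b))    ∎
      where open ≡-Reasoning

    α-sum : ∀ a b → a ≤ ρ → b ≤ ρ' → α a + α' b ≡ product-α (a + b)
    α-sum a b a≤ρ b≤ρ' = begin
      α a + α' b
        ≡⟨ middle-sum (γ a) (α a) (β a) (γ' b) (α' b) (β' b) D D'
             (A.valency-sum (symmetric G) (regular G) a a≤ρ) (B.valency-sum (symmetric G') (regular G') b b≤ρ') ⟩
      (D + D') ∸ ((γ a + γ' b) + (β a + β' b))
        ≡⟨ cong (λ t → (D + D') ∸ t) (cong₂ _+_ (γ-sum a b a≤ρ b≤ρ') (β-sum a b a≤ρ b≤ρ')) ⟩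
      product-α (a + b) ∎
      where open ≡-Reasoning

    conditions-sufficient : IsCompletelyRegular P CC (ρ + ρ') product-γ product-α product-β
    conditions-sufficient = product-completely-regular product-γ product-α product-β
      (λ a b a≤ρ b≤ρ' → γ-sum a b a≤ρ b≤ρ' , α-sum a b a≤ρ b≤ρ' , β-sum a b a≤ρ b≤ρ')

    parameters-forced : ∀ ρ̄ γ̄ ᾱ β̄ → IsCompletelyRegular P CC ρ̄ γ̄ ᾱ β̄ →
      (ρ̄ ≡ ρ + ρ') × (∀ i → i ≤ ρ̄ → γ̄ i ≡ n₁ * i) × (∀ i → i ≤ ρ̄ → β̄ i ≡ n₂ * (ρ̄ ∸ i))
    parameters-forced ρ̄ γ̄ ᾱ β̄ crp with parameters-unique P CC conditions-sufficient crp
    ... | refl , same = refl , (λ i i≤ρ̄ → sym (proj₁ (same i i≤ρ̄))) , (λ i i≤ρ̄ → sym (proj₂ (proj₂ (same i i≤ρ̄))))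


proposition3p4 : (n q n' q' : ℕ) (C : Code (H n q)) (C' : Code (H n' q'))
    (ρ ρ' : ℕ) (γ α β γ' α' β' : ℕ → ℕ) →
    NonTrivial {H n q} C → IsCompletelyRegular (H n q) C ρ γ α β → 1 ≤ ρ →
    NonTrivial {H n' q'} C' → IsCompletelyRegular (H n' q') C' ρ' γ' α' β' → 1 ≤ ρ' →
    ρ ≤ ρ' →
    (CompletelyRegular (H n q □ H n' q') (_⊠_ {H n q} {H n' q'} C C')
       ⇔ (∃[ n₁ ] ∃[ n₂ ] ParamCondition ρ ρ' γ β γ' β' n₁ n₂))
    × (∀ n₁ n₂ → ParamCondition ρ ρ' γ β γ' β' n₁ n₂ →
         ∀ ρ̄ γ̄ ᾱ β̄ →
         IsCompletelyRegular (H n q □ H n' q') (_⊠_ {H n q} {H n' q'} C C') ρ̄ γ̄ ᾱ β̄ →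
         (ρ̄ ≡ ρ + ρ')
         × (∀ i → i ≤ ρ̄ → γ̄ i ≡ n₁ * i)
         × (∀ i → i ≤ ρ̄ → β̄ i ≡ n₂ * (ρ̄ ∸ i)))
proposition3p4 n q n' q' C C' ρ ρ' γ α β γ' α' β' _ cr 1≤ρ _ cr' 1≤ρ' _ =
  mk⇔ (conditions-necessary 1≤ρ 1≤ρ')
      (λ (n₁ , n₂ , conditions) → ρ + ρ' , _ , _ , _ , conditions-sufficient n₁ n₂ conditions) ,
  parameters-forced
  where
  open ParameterConditions (H n q) (H n' q') (n * (q ∸ 1)) (n' * (q' ∸ 1))
    hamming-simple-regular hamming-simple-regular C ρ γ α β cr C' ρ' γ' α' β' cr'
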